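{- The natural deduction system for $\mathcal{L}_u$ is complete: for every set $\Gamma\cup\{\phi\}$ of $\mathcal{L}_u$-formulas, if $\Gamma\models\phi$ then $\Gamma\vdash\phi$.
   Context: Fix a finite set $\mathbb{P}$ of propositional symbols; a valuation is $v:\mathbb{P}\to\{0,1\}$ with $v(\top)=1,v(\bot)=0$; a team is a set of valuations. $\mathcal{L}_u$: $\phi::=\top\mid\mathsf{x}\subseteqq\mathsf{p}\mid\phi\land\phi\mid\phi\sqcup\phi$, with $\mathsf{x}$ a finite sequence of constants $\top,\bot$, $\mathsf{p}$ a sequence of symbols of $\mathbb{P}$ without repetitions, $|\mathsf{x}|=|\mathsf{p}|$. Semantics: $T\models\top$ always; $T\models\mathsf{x}\subseteqq\mathsf{p}$ iff $T\neq\emptyset$ and for every $v\in T$ there is $v'\in T$ with $v(\mathsf{x})=v'(\mathsf{p})$; $\land$ as usual; $T\models\phi\sqcup\psi$ iff $T\models\phi$ or $T\models\psi$. $\Gamma\models\phi$ iff every team satisfying all of $\Gamma$ satisfies $\phi$. $\Gamma\vdash\phi$ means a natural deduction derivation of $\phi$ with undischarged assumptions in $\Gamma$ using: ($\top$I) infer $\top$; ($\land$I) from $\phi,\psi$ infer $\phi\land\psi$; ($\land$E) from $\phi\land\psi$ infer $\phi$, and $\psi$; ($\sqcup$I) from $\phi$ infer $\phi\sqcup\psi$ and $\psi\sqcup\phi$; ($\sqcup$E) from $\phi\sqcup\psi$ and derivations of $\chi$ from $\phi$ and from $\psi$, infer $\chi$ discharging them; ($\subseteqq$Proj) from $\mathsf{x}y\subseteqq\mathsf{p}q$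 infer $\mathsf{x}\subseteqq\mathsf{p}$; ($\subseteqq$Perm) from $\mathsf{x}\mathsf{y}\mathsf{z}\subseteqq\mathsf{u}\mathsf{v}\mathsf{w}$ infer $\mathsf{x}\mathsf{z}\mathsf{y}\subseteqq\mathsf{u}\mathsf{w}\mathsf{v}$ provided $|\mathsf{y}|=|\mathsf{v}|$, $|\mathsf{z}|=|\mathsf{w}|$; ($\subseteqq$Ext) from $\mathsf{x}\subseteqq\mathsf{p}$ and derivations of $\chi$ from $\mathsf{x}\top\subseteqq\mathsf{p}q$ and from $\mathsf{x}\bot\subseteqq\mathsf{p}q$ ($q$ a symbol not in $\mathsf{p}$), infer $\chi$ discharging them. -}

module Defs where

open import Data.Nat using (ℕ)
open import Data.Fin using (Fin)
open import Data.Bool using (Bool; true; false)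
open import Data.Vec using (Vec; []; _∷_; _++_; map; toList)
open import Data.List.Relation.Unary.Unique.Propositional using (Unique)
open import Data.List.Membership.Propositional using (_∉_)
open import Data.Product using (Σ; ∃; _×_; _,_)
open import Data.Sum using (_⊎_)
open import Relation.Binary.PropositionalEquality using (_≡_)

-- Propositional symbols: ℙ = Fin n (an arbitrary finite set).
-- Constants ⊤ / ⊥ are represented by true / false : Bool, so that
-- v(⊤) = 1 and v(⊥) = 0 means a constant evaluates to itself.
Valuation : ℕ → Set
Valuation n = Fin n → Bool

-- A team is a set of valuations; since there are finitely many valuations,
-- every such set is given by its (decidable) characteristic function.
Team : ℕ → Set
Team n = Valuation n → Bool

_∈ᵀ_ : ∀ {n} → Valuation n → Team n → Set
v ∈ᵀ T = T v ≡ true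

Distinct : ∀ {n k} → Vec (Fin n) k → Set
Distinct ps = Unique (toList ps)

-- Formulas of L_u.  incl xs ps  is  xs ⊆⊆ ps  (|xs| = |ps| by the shared
-- index k; ps without repetitions, proof irrelevant).
data Formula (n : ℕ) : Set where
  ⊤ᶠ   : Formula n
  incl : ∀ {k} (xs : Vec Bool k) (ps : Vec (Fin n) k) → .(Distinct ps) → Formula n
  _∧ᶠ_ : Formula n → Formula n → Formula n
  _⊔ᶠ_ : Formula n → Formula n → Formula n

_⊨_ : ∀ {n} → Team n → Formula n → Set
T ⊨ ⊤ᶠ = Data.Unit.⊤ where import Data.Unit
T ⊨ incl xs ps _ =
  (∃ λ v → v ∈ᵀ T) ×
  (∀ v → v ∈ᵀ T → ∃ λ v' → v' ∈ᵀ T × xs ≡ map v' ps)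
T ⊨ (φ ∧ᶠ ψ) = (T ⊨ φ) × (T ⊨ ψ)
T ⊨ (φ ⊔ᶠ ψ) = (T ⊨ φ) ⊎ (T ⊨ ψ)

Ctx : ℕ → Set₁
Ctx n = Formula n → Set

_,,_ : ∀ {n} → Ctx n → Formula n → Ctx n
(Γ ,, φ) ψ = Γ ψ ⊎ ψ ≡ φ

_⊨ˢ_ : ∀ {n} → Ctx n → Formula n → Set
Γ ⊨ˢ φ = ∀ T → (∀ ψ → Γ ψ → T ⊨ ψ) → T ⊨ φ

infix 4 _⊢_
data _⊢_ {n : ℕ} : Ctx n → Formula n → Set₁ where
  assm : ∀ {Γ φ} → Γ φ → Γ ⊢ φ
  ⊤I   : ∀ {Γ} → Γ ⊢ ⊤ᶠ
  ∧I   : ∀ {Γ φ ψ} → Γ ⊢ φ → Γ ⊢ ψ → Γ ⊢ φ ∧ᶠ ψ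
  ∧E₁  : ∀ {Γ φ ψ} → Γ ⊢ φ ∧ᶠ ψ → Γ ⊢ φ
  ∧E₂  : ∀ {Γ φ ψ} → Γ ⊢ φ ∧ᶠ ψ → Γ ⊢ ψ
  ⊔I₁  : ∀ {Γ φ ψ} → Γ ⊢ φ → Γ ⊢ φ ⊔ᶠ ψ
  ⊔I₂  : ∀ {Γ φ ψ} → Γ ⊢ ψ → Γ ⊢ φ ⊔ᶠ ψ
  ⊔E   : ∀ {Γ φ ψ χ} → Γ ⊢ φ ⊔ᶠ ψ → (Γ ,, φ) ⊢ χ → (Γ ,, ψ) ⊢ χ → Γ ⊢ χ
  ⊆Proj : ∀ {Γ k} {xs : Vec Bool k} {y : Bool} {ps : Vec (Fin n) k} {q : Fin n}
          .{d₁ : Distinct (ps ++ q ∷ [])} .{d₂ : Distinct ps} →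
          Γ ⊢ incl (xs ++ y ∷ []) (ps ++ q ∷ []) d₁ → Γ ⊢ incl xs ps d₂
  -- from  x y z ⊆⊆ u v w  infer  x z y ⊆⊆ u w v  (|y| = |v|, |z| = |w|)
  ⊆Perm : ∀ {Γ a b c} {xs : Vec Bool a} {ys : Vec Bool b} {zs : Vec Bool c}
          {us : Vec (Fin n) a} {vs : Vec (Fin n) b} {ws : Vec (Fin n) c}
          .{d₁ : Distinct (us ++ vs ++ ws)} .{d₂ : Distinct (us ++ ws ++ vs)} →
          Γ ⊢ incl (xs ++ ys ++ zs) (us ++ vs ++ ws) d₁ →
          Γ ⊢ incl (xs ++ zs ++ ys) (us ++ ws ++ vs) d₂
  -- from  x ⊆⊆ p  and derivations of χ from  x⊤ ⊆⊆ pq  and from  x⊥ ⊆⊆ pq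
  -- (q ∉ p), infer χ
  ⊆Ext : ∀ {Γ k χ} {xs : Vec Bool k} {ps : Vec (Fin n) k} {q : Fin n}
          .{d : Distinct ps} .{d⊤ d⊥ : Distinct (ps ++ q ∷ [])} →
          q ∉ toList ps →
          Γ ⊢ incl xs ps d →
          (Γ ,, incl (xs ++ true ∷ []) (ps ++ q ∷ []) d⊤) ⊢ χ →
          (Γ ,, incl (xs ++ false ∷ []) (ps ++ q ∷ []) d⊥) ⊢ χ →
          Γ ⊢ χ

-- Every L_u-formula is upward closed, and if Δ derives all atoms v(p) ⊆⊆ p of every member v of
-- a team T, then Δ derives every formula that T satisfies. Starting from the empty team, as long
-- as the current team misses some ψ ∈ Γ we unfold a derivation of ψ: ⊔E splits into cases, and a
-- derived atom x ⊆⊆ p is extended by ⊆Ext, one symbol at a time, to a valuation w on all of ℙ,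
-- all of whose atoms then follow by ⊆Perm and ⊆Proj. Adding w gives, in every branch, a strictly
-- larger team satisfying ψ. As there are finitely many teams, every branch ends with a team
-- satisfying Γ, hence φ. Excluded middle is only used to decide whether a team satisfies the
-- possibly infinite Γ.
module Submission where

open import Defs
open import Level using (0ℓ)
open import Data.Nat using (ℕ; _^_)
open import Axiom.ExcludedMiddle using (ExcludedMiddle)
open import Axiom.DoubleNegationElimination using (em⇒dne)

open import Data.Bool using (Bool; true; false)
open import Data.Fin using (Fin; _≟_; finToFun; funToFin)
open import Data.Fin.Properties using (2↔Bool; finToFun-funToFin)
open import Data.Fin.Subset using (Subset; _∪_; ⁅_⁆; _⊂_; _⊃_)
  renaming (_∈_ to _∈ₛ_; _⊆_ to _⊆ₛ_; ⊥ to ∅)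
open import Data.Fin.Subset.Properties
  using (_∈?_; _⊂?_; ∉⊥; x∈⁅x⁆; x∈⁅y⁆⇒x≡y; p⊆p∪q; x∈p∪q⁺; x∈p∪q⁻)
open import Data.Fin.Subset.Induction using (Acc; acc; ⊃-wellFounded)
open import Data.List using (List; []; _∷_; _++_; [_]; length; allFin)
open import Data.List.Properties using (++-assoc; ++-identityʳ)
open import Data.List.Membership.Propositional using (_∈_; _∉_)
open import Data.List.Membership.Propositional.Properties using (∈-∃++; ∈-++⁺ˡ; ∈-++⁺ʳ; ∈-allFin)
open import Data.List.Relation.Binary.Subset.Propositional using () renaming (_⊆_ to _⊆ˡ_)
open import Data.List.Relation.Binary.Permutation.Propositional using (_↭_; ↭-sym; ↭⇒↭ₛ)
open import Data.List.Relation.Binary.Permutation.Propositional.Properties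
  using (++⁺ˡ; ++-comm; ∷↭∷ʳ; ∈-resp-↭)
import Data.List.Relation.Binary.Permutation.Setoid.Properties as ↭ₛ
open import Data.List.Relation.Unary.All as All using ()
open import Data.List.Relation.Unary.All.Properties using (¬Any⇒All¬)
open import Data.List.Relation.Unary.Any using (here; there)
open import Data.List.Relation.Unary.AllPairs using (_∷_)
open import Data.List.Relation.Unary.Unique.Propositional using (Unique)
open import Data.List.Relation.Unary.Unique.Propositional.Properties using (Unique[x∷xs]⇒x∉xs)
open import Data.Product using (Σ; ∃; ∃₂; _×_; _,_; proj₁; proj₂)
open import Data.Sum using (_⊎_; inj₁; inj₂)
open import Data.Unit using (tt)
open import Data.Vec using (Vec; []; _∷_; map; toList; fromList; lookup) renaming (_++_ to _++ᵛ_)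
open import Data.Vec.Properties
  using (map-++; map-cong; toList-++; toList∘fromList; length-toList; toList-injective; cast-is-id;
         []=⇒lookup; lookup⇒[]=)
open import Data.Vec.Functional using (Vector; updateAt)
open import Data.Vec.Functional.Properties using (updateAt-updates; updateAt-minimal)
open import Function using (id; _∘_; const; Inverse)
open import Relation.Binary.PropositionalEquality
  using (_≡_; refl; sym; trans; cong; cong₂; subst; _≗_; setoid)
open import Relation.Nullary using (¬_; yes; no; contradiction)
open import Relation.Nullary.Decidable using (recompute; decidable-stable)

module _ {A : Set} where

  Unique-resp-↭ : ∀ {xs ys : List A} → xs ↭ ys → Unique xs → Unique ys
  Unique-resp-↭ = ↭ₛ.Unique-resp-↭ (setoid A) ∘ ↭⇒↭ₛ

  Unique-∷ʳ⁺ : ∀ {xs : List A} {x} → Unique xs → x ∉ xs → Unique (xs ++ [ x ])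
  Unique-∷ʳ⁺ {xs} {x} u x∉xs = Unique-resp-↭ (∷↭∷ʳ x xs) (¬Any⇒All¬ xs x∉xs ∷ u)

  Unique-∷ʳ⁻ : ∀ {xs : List A} {x} → Unique (xs ++ [ x ]) → Unique xs
  Unique-∷ʳ⁻ {xs} {x} u with Unique-resp-↭ (↭-sym (∷↭∷ʳ x xs)) u
  ... | _ ∷ u′ = u′

  toList-fromList-++ : ∀ (xs : List A) {k} (ys : Vec A k) → toList (fromList xs ++ᵛ ys) ≡ xs ++ toList ys
  toList-fromList-++ xs ys =
    trans (toList-++ (fromList xs) ys) (cong (_++ toList ys) (toList∘fromList xs))

  map-cong-∈ : ∀ {B : Set} {f g : A → B} {k} (xs : Vec A k) →
               (∀ {x} → x ∈ toList xs → f x ≡ g x) → map f xs ≡ map g xs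
  map-cong-∈ []       f≡g = refl
  map-cong-∈ (x ∷ xs) f≡g = cong₂ _∷_ (f≡g (here refl)) (map-cong-∈ xs (f≡g ∘ there))

map-updateAt-∉ : ∀ {A : Set} {m k} {v : Vector A m} {i f} (is : Vec (Fin m) k) →
                 i ∉ toList is → map (updateAt v i f) is ≡ map v is
map-updateAt-∉ {v = v} {i} is i∉is =
  map-cong-∈ is λ {j} j∈is → updateAt-minimal j i v λ j≡i → i∉is (subst (_∈ toList is) j≡i j∈is)

⊆⇒⊂⊎⊇ : ∀ {m} {S S′ : Subset m} → S ⊆ₛ S′ → S ⊂ S′ ⊎ S′ ⊆ₛ S
⊆⇒⊂⊎⊇ {S = S} {S′} S⊆S′ with S ⊂? S′
... | yes S⊂S′ = inj₁ S⊂S′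
... | no  S⊄S′ = inj₂ λ {x} x∈S′ → decidable-stable (x ∈? S) λ x∉S → S⊄S′ (S⊆S′ , x , x∈S′ , x∉S)

module _ {n : ℕ} where

  open import Data.List.Membership.DecPropositional (_≟_ {n}) using () renaming (_∈?_ to _∈ˡ?_)
  open import Data.List.Relation.Unary.Unique.DecPropositional (_≟_ {n}) using (unique?)

  infix 4 _⊆ᶜ_ _⊩_ _⊆ᵀ_ _⊢-atoms_ _⊢-team_ _⊢⟨_⟩_

  _⊆ᶜ_ : Ctx n → Ctx n → Set
  Δ ⊆ᶜ Δ′ = ∀ ψ → Δ ψ → Δ′ ψ

  ⊆ᶜ-trans : ∀ {Δ₁ Δ₂ Δ₃} → Δ₁ ⊆ᶜ Δ₂ → Δ₂ ⊆ᶜ Δ₃ → Δ₁ ⊆ᶜ Δ₃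
  ⊆ᶜ-trans s s′ ψ = s′ ψ ∘ s ψ

  ,,⁺ : ∀ {Δ Δ′} φ → Δ ⊆ᶜ Δ′ → (Δ ,, φ) ⊆ᶜ (Δ′ ,, φ)
  ,,⁺ φ s ψ (inj₁ ψ∈Δ) = inj₁ (s ψ ψ∈Δ)
  ,,⁺ φ s ψ (inj₂ ψ≡φ) = inj₂ ψ≡φ

  weaken : ∀ {Δ Δ′ φ} → Δ ⊆ᶜ Δ′ → Δ ⊢ φ → Δ′ ⊢ φ
  weaken s (assm ψ∈Δ)      = assm (s _ ψ∈Δ)
  weaken s ⊤I              = ⊤I
  weaken s (∧I D E)        = ∧I (weaken s D) (weaken s E)
  weaken s (∧E₁ D)         = ∧E₁ (weaken s D)
  weaken s (∧E₂ D)         = ∧E₂ (weaken s D)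
  weaken s (⊔I₁ D)         = ⊔I₁ (weaken s D)
  weaken s (⊔I₂ D)         = ⊔I₂ (weaken s D)
  weaken s (⊔E D E F)      = ⊔E (weaken s D) (weaken (,,⁺ _ s) E) (weaken (,,⁺ _ s) F)
  weaken s (⊆Proj {xs = xs} {y} {ps} {q} D) = ⊆Proj {xs = xs} {y} {ps} {q} (weaken s D)
  weaken s (⊆Perm {xs = xs} {ys} {zs} {us} {vs} {ws} D) =
    ⊆Perm {xs = xs} {ys} {zs} {us} {vs} {ws} (weaken s D)
  weaken s (⊆Ext q∉ D E F) = ⊆Ext q∉ (weaken s D) (weaken (,,⁺ _ s) E) (weaken (,,⁺ _ s) F)

  -- Case splits in continuation-passing style: the extensions Δ′ are the branches opened by ⊔E and ⊆Ext.
  record _⊩_ (Δ : Ctx n) (P : Ctx n → Set₁) : Set₁ where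
    constructor branching
    field run : ∀ {χ} → (∀ {Δ′} → Δ ⊆ᶜ Δ′ → P Δ′ → Δ′ ⊢ χ) → Δ ⊢ χ
  open _⊩_

  ⊩-return : ∀ {Δ P} → P Δ → Δ ⊩ P
  ⊩-return p = branching λ k → k (λ _ → id) p

  ⊩-bind : ∀ {Δ P Q} → Δ ⊩ P → (∀ {Δ′} → Δ ⊆ᶜ Δ′ → P Δ′ → Δ′ ⊩ Q) → Δ ⊩ Q
  ⊩-bind m f = branching λ k → run m λ s p → run (f s p) λ s′ → k (⊆ᶜ-trans s s′)

  ⊩-map : ∀ {Δ P Q} → (∀ {Δ′} → P Δ′ → Q Δ′) → Δ ⊩ P → Δ ⊩ Q
  ⊩-map f m = branching λ k → run m λ s p → k s (f p)

  ⊔-cases : ∀ {Δ φ ψ} → Δ ⊢ φ ⊔ᶠ ψ → Δ ⊩ λ Δ′ → Δ′ ⊢ φ ⊎ Δ′ ⊢ ψ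
  ⊔-cases D = branching λ k →
    ⊔E D (k (λ _ → inj₁) (inj₁ (assm (inj₂ refl)))) (k (λ _ → inj₁) (inj₂ (assm (inj₂ refl))))

  _⊆ᵀ_ : Team n → Team n → Set
  T ⊆ᵀ T′ = ∀ {v} → v ∈ᵀ T → v ∈ᵀ T′

  ⊨-mono : ∀ {T T′} φ → T ⊆ᵀ T′ → T ⊨ φ → T′ ⊨ φ
  ⊨-mono ⊤ᶠ           T⊆T′ _                     = tt
  ⊨-mono (incl _ _ _) T⊆T′ ((v , v∈T) , witness) with witness v v∈T
  ... | v′ , v′∈T , xs≡ = (v , T⊆T′ v∈T) , λ _ _ → v′ , T⊆T′ v′∈T , xs≡
  ⊨-mono (φ ∧ᶠ ψ)     T⊆T′ (Tφ , Tψ)             = ⊨-mono φ T⊆T′ Tφ , ⊨-mono ψ T⊆T′ Tψ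
  ⊨-mono (φ ⊔ᶠ ψ)     T⊆T′ (inj₁ Tφ)             = inj₁ (⊨-mono φ T⊆T′ Tφ)
  ⊨-mono (φ ⊔ᶠ ψ)     T⊆T′ (inj₂ Tψ)             = inj₂ (⊨-mono ψ T⊆T′ Tψ)

  subst-incl : ∀ {Δ k} {xs xs′ : Vec Bool k} {ps : Vec (Fin n) k} .{d} →
               xs ≡ xs′ → Δ ⊢ incl xs ps d → Δ ⊢ incl xs′ ps d
  subst-incl refl D = D

  _⊢-atoms_ : Ctx n → Valuation n → Set₁
  Δ ⊢-atoms w = ∀ {k} (ps : Vec (Fin n) k) .(d : Distinct ps) → Δ ⊢ incl (map w ps) ps d

  ⊢-atoms-resp : ∀ {Δ v w} → v ≗ w → Δ ⊢-atoms w → Δ ⊢-atoms v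
  ⊢-atoms-resp v≗w W ps d = subst-incl (sym (map-cong v≗w ps)) (W ps d)

  _⊢-team_ : Ctx n → Team n → Set₁
  Δ ⊢-team T = ∀ {v} → v ∈ᵀ T → Δ ⊢-atoms v

  ⊢-team-weaken : ∀ {Δ Δ′ T} → Δ ⊆ᶜ Δ′ → Δ ⊢-team T → Δ′ ⊢-team T
  ⊢-team-weaken s F v∈T ps d = weaken s (F v∈T ps d)

  ⊢-team⇒⊢ : ∀ {Δ T} φ → Δ ⊢-team T → T ⊨ φ → Δ ⊢ φ
  ⊢-team⇒⊢ ⊤ᶠ             F _                     = ⊤I
  ⊢-team⇒⊢ (incl xs ps d) F ((v , v∈T) , witness) with witness v v∈T
  ... | v′ , v′∈T , xs≡ = subst-incl (sym xs≡) (F v′∈T ps d)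
  ⊢-team⇒⊢ (φ ∧ᶠ ψ)       F (Tφ , Tψ)             = ∧I (⊢-team⇒⊢ φ F Tφ) (⊢-team⇒⊢ ψ F Tψ)
  ⊢-team⇒⊢ (φ ⊔ᶠ ψ)       F (inj₁ Tφ)             = ⊔I₁ (⊢-team⇒⊢ φ F Tφ)
  ⊢-team⇒⊢ (φ ⊔ᶠ ψ)       F (inj₂ Tψ)             = ⊔I₂ (⊢-team⇒⊢ ψ F Tψ)

  _[_]≔_ : Valuation n → Fin n → Bool → Valuation n
  w [ q ]≔ b = updateAt w q (const b)

  reindex : ∀ {Δ w k k′} {ps : Vec (Fin n) k} {ps′ : Vec (Fin n) k′} .{d d′} →
            toList ps ≡ toList ps′ → Δ ⊢ incl (map w ps) ps d → Δ ⊢ incl (map w ps′) ps′ d′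
  reindex {ps = ps} {ps′} eq D
    with refl ← trans (sym (length-toList ps)) (trans (cong length eq) (length-toList ps′))
    with refl ← trans (sym (cast-is-id refl ps)) (toList-injective refl ps ps′ eq)
    = D

  atom-perm : ∀ {Δ w a b c} (us : Vec (Fin n) a) (vs : Vec (Fin n) b) (ws : Vec (Fin n) c) .{d d′} →
              Δ ⊢ incl (map w (us ++ᵛ vs ++ᵛ ws)) (us ++ᵛ vs ++ᵛ ws) d →
              Δ ⊢ incl (map w (us ++ᵛ ws ++ᵛ vs)) (us ++ᵛ ws ++ᵛ vs) d′
  atom-perm {w = w} us vs ws D
    rewrite map-++ w us (vs ++ᵛ ws) | map-++ w vs ws | map-++ w us (ws ++ᵛ vs) | map-++ w ws vs
    = ⊆Perm {xs = map w us} {map w vs} {map w ws} {us} {vs} {ws} D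

  atom-init : ∀ {Δ w k} (ps : Vec (Fin n) k) {q} .{d d′} →
              Δ ⊢ incl (map w (ps ++ᵛ q ∷ [])) (ps ++ᵛ q ∷ []) d → Δ ⊢ incl (map w ps) ps d′
  atom-init {w = w} ps {q} D rewrite map-++ w ps (q ∷ []) = ⊆Proj {xs = map w ps} {w q} {ps} {q} D

  atom-ext : ∀ {Δ w k} (ps : Vec (Fin n) k) {q} .{d d′} → q ∉ toList ps → Δ ⊢ incl (map w ps) ps d →
             Δ ⊩ λ Δ′ → ∃ λ b → Δ′ ⊢ incl (map (w [ q ]≔ b) (ps ++ᵛ q ∷ [])) (ps ++ᵛ q ∷ []) d′
  atom-ext {w = w} ps {q} {d′ = d′} q∉ps D = branching λ k →
    ⊆Ext {d⊤ = d′} {d⊥ = d′} q∉ps D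
      (k (λ _ → inj₁) (true , subst-incl (sym (fresh true)) (assm (inj₂ refl))))
      (k (λ _ → inj₁) (false , subst-incl (sym (fresh false)) (assm (inj₂ refl))))
    where
    fresh : ∀ b → map (w [ q ]≔ b) (ps ++ᵛ q ∷ []) ≡ map w ps ++ᵛ b ∷ []
    fresh b = trans (map-++ _ ps (q ∷ []))
                    (cong₂ _++ᵛ_ (map-updateAt-∉ ps q∉ps) (cong (_∷ []) (updateAt-updates q w)))

  Unique-fromList : ∀ {l : List (Fin n)} → Unique l → Distinct (fromList l)
  Unique-fromList {l} = subst Unique (sym (toList∘fromList l))

  -- Atoms over lists rather than vectors, so that the block rearrangements of ⊆Perm and ⊆Proj
  -- need no length arithmetic.
  _⊢⟨_⟩_ : Ctx n → Valuation n → List (Fin n) → Set₁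
  Δ ⊢⟨ w ⟩ l = Σ (Unique l) λ u → Δ ⊢ incl (map w (fromList l)) (fromList l) (Unique-fromList u)

  ⊢⟨⟩⁺ : ∀ {Δ w l k} {ps : Vec (Fin n) k} (eq : toList ps ≡ l) (u : Unique l) →
         Δ ⊢ incl (map w ps) ps (subst Unique (sym eq) u) → Δ ⊢⟨ w ⟩ l
  ⊢⟨⟩⁺ {l = l} eq u D = u , reindex (trans eq (sym (toList∘fromList l))) D

  ⊢⟨⟩⁻ : ∀ {Δ w l k} {ps : Vec (Fin n) k} (D : Δ ⊢⟨ w ⟩ l) (eq : toList ps ≡ l) →
         Δ ⊢ incl (map w ps) ps (subst Unique (sym eq) (proj₁ D))
  ⊢⟨⟩⁻ {l = l} (u , D) eq = reindex (trans (toList∘fromList l) (sym eq)) D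

  ⊢⟨⟩-swap : ∀ {Δ w} us vs ws → Δ ⊢⟨ w ⟩ us ++ vs ++ ws → Δ ⊢⟨ w ⟩ us ++ ws ++ vs
  ⊢⟨⟩-swap us vs ws D =
    ⊢⟨⟩⁺ (blocks us ws vs) (Unique-resp-↭ (++⁺ˡ us (++-comm vs ws)) (proj₁ D))
      (atom-perm (fromList us) (fromList vs) (fromList ws) (⊢⟨⟩⁻ D (blocks us vs ws)))
    where
    blocks : ∀ us vs ws → toList (fromList us ++ᵛ fromList vs ++ᵛ fromList ws) ≡ us ++ vs ++ ws
    blocks us vs ws = trans (toList-fromList-++ us _)
      (cong (us ++_) (trans (toList-fromList-++ vs _) (cong (vs ++_) (toList∘fromList ws))))

  ⊢⟨⟩-init : ∀ {Δ w} l {q} → Δ ⊢⟨ w ⟩ l ++ [ q ] → Δ ⊢⟨ w ⟩ l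
  ⊢⟨⟩-init l {q} D =
    ⊢⟨⟩⁺ (toList∘fromList l) (Unique-∷ʳ⁻ (proj₁ D))
      (atom-init (fromList l) (⊢⟨⟩⁻ D (toList-fromList-++ l (q ∷ []))))

  ⊢⟨⟩-ext : ∀ {Δ w l q} → q ∉ l → Δ ⊢⟨ w ⟩ l → Δ ⊩ λ Δ′ → ∃ λ b → Δ′ ⊢⟨ w [ q ]≔ b ⟩ l ++ [ q ]
  ⊢⟨⟩-ext {l = l} {q} q∉l D =
    ⊩-map (λ (b , E) → b , ⊢⟨⟩⁺ (toList-fromList-++ l (q ∷ [])) (Unique-∷ʳ⁺ (proj₁ D) q∉l) E)
      (atom-ext (fromList l) (subst (q ∉_) (sym (toList∘fromList l)) q∉l) (⊢⟨⟩⁻ D (toList∘fromList l)))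

  ⊢⟨⟩-prefix : ∀ {Δ w} l l′ → Δ ⊢⟨ w ⟩ l ++ l′ → Δ ⊢⟨ w ⟩ l
  ⊢⟨⟩-prefix {Δ} {w} l []       D = subst (Δ ⊢⟨ w ⟩_) (++-identityʳ l) D
  ⊢⟨⟩-prefix {Δ} {w} l (q ∷ l′) D =
    ⊢⟨⟩-init l (⊢⟨⟩-prefix (l ++ [ q ]) l′ (subst (Δ ⊢⟨ w ⟩_) (sym (++-assoc l [ q ] l′)) D))

  -- One block swap brings the next q ∈ qs right behind the part pre already selected.
  ⊢⟨⟩-select : ∀ {Δ w} pre {qs l} → Unique qs → qs ⊆ˡ l → Δ ⊢⟨ w ⟩ pre ++ l → Δ ⊢⟨ w ⟩ pre ++ qs
  ⊢⟨⟩-select {Δ} {w} pre {[]} {l} _ _ D = subst (Δ ⊢⟨ w ⟩_) (sym (++-identityʳ pre)) (⊢⟨⟩-prefix pre l D)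
  ⊢⟨⟩-select {Δ} {w} pre {q ∷ qs} (q∉qs ∷ u) qs⊆l D with ∈-∃++ (qs⊆l (here refl))
  ... | us , ws , refl =
    subst (Δ ⊢⟨ w ⟩_) (++-assoc pre [ q ] qs)
      (⊢⟨⟩-select (pre ++ [ q ]) u qs⊆ws++us
        (subst (Δ ⊢⟨ w ⟩_) (sym (++-assoc pre [ q ] (ws ++ us))) (⊢⟨⟩-swap pre us (q ∷ ws) D)))
    where
    qs⊆ws++us : qs ⊆ˡ ws ++ us
    qs⊆ws++us x∈qs with ∈-resp-↭ (++-comm us (q ∷ ws)) (qs⊆l (there x∈qs))
    ... | here x≡q = contradiction (sym x≡q) (All.lookup q∉qs x∈qs)
    ... | there x∈ = x∈

  ⊢⟨⟩-total⇒⊢-atoms : ∀ {Δ w l} → (∀ q → q ∈ l) → Δ ⊢⟨ w ⟩ l → Δ ⊢-atoms w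
  ⊢⟨⟩-total⇒⊢-atoms total D ps d =
    ⊢⟨⟩⁻ (⊢⟨⟩-select [] (recompute (unique? (toList ps)) d) (λ {q} _ → total q) D) refl

  _↾_⊑_↾_ : Valuation n → List (Fin n) → Valuation n → List (Fin n) → Set
  w ↾ l ⊑ w′ ↾ l′ = ∀ p → p ∈ l → p ∈ l′ × w′ p ≡ w p

  ⊑-refl : ∀ {w l} → w ↾ l ⊑ w ↾ l
  ⊑-refl _ p∈l = p∈l , refl

  ⊑-trans : ∀ {w₁ w₂ w₃ l₁ l₂ l₃} → w₁ ↾ l₁ ⊑ w₂ ↾ l₂ → w₂ ↾ l₂ ⊑ w₃ ↾ l₃ → w₁ ↾ l₁ ⊑ w₃ ↾ l₃
  ⊑-trans ⊑₁₂ ⊑₂₃ p p∈l₁ with ⊑₁₂ p p∈l₁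
  ... | p∈l₂ , w₂p≡w₁p with ⊑₂₃ p p∈l₂
  ... | p∈l₃ , w₃p≡w₂p = p∈l₃ , trans w₃p≡w₂p w₂p≡w₁p

  ⊑-[]≔ : ∀ {w l q b} → q ∉ l → w ↾ l ⊑ (w [ q ]≔ b) ↾ (l ++ [ q ])
  ⊑-[]≔ {w} {l} {q} q∉l p p∈l =
    ∈-++⁺ˡ p∈l , updateAt-minimal p q w λ p≡q → q∉l (subst (_∈ l) p≡q p∈l)

  Extension : Valuation n → List (Fin n) → List (Fin n) → Ctx n → Set₁
  Extension w l qs Δ = ∃₂ λ w′ l′ → Δ ⊢⟨ w′ ⟩ l′ × qs ⊆ˡ l′ × w ↾ l ⊑ w′ ↾ l′

  cover : ∀ {Δ w l} q → Δ ⊢⟨ w ⟩ l → Δ ⊩ Extension w l [ q ]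
  cover {l = l} q D with q ∈ˡ? l
  ... | yes q∈l = ⊩-return (_ , _ , D , (λ { (here refl) → q∈l }) , ⊑-refl)
  ... | no  q∉l = ⊩-map (λ (_ , E) → _ , _ , E , (λ { (here refl) → ∈-++⁺ʳ l (here refl) }) , ⊑-[]≔ q∉l)
                        (⊢⟨⟩-ext q∉l D)

  saturate : ∀ {Δ w l} qs → Δ ⊢⟨ w ⟩ l → Δ ⊩ Extension w l qs
  saturate []       D = ⊩-return (_ , _ , D , (λ ()) , ⊑-refl)
  saturate (q ∷ qs) D = ⊩-bind (cover q D) λ _ (_ , _ , D′ , q∈ , ⊑₁) →
    ⊩-map (λ (w″ , l″ , D″ , qs⊆ , ⊑₂) →
             w″ , l″ , D″ ,
             (λ { (here refl) → proj₁ (⊑₂ q (q∈ (here refl))) ; (there x∈qs) → qs⊆ x∈qs }) ,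
             ⊑-trans ⊑₁ ⊑₂)
          (saturate qs D′)

  assign : ∀ {k} → Vec Bool k → Vec (Fin n) k → Valuation n
  assign []       []       = const false
  assign (x ∷ xs) (p ∷ ps) = assign xs ps [ p ]≔ x

  map-assign : ∀ {k} (xs : Vec Bool k) (ps : Vec (Fin n) k) → Distinct ps → map (assign xs ps) ps ≡ xs
  map-assign []       []       _          = refl
  map-assign (x ∷ xs) (p ∷ ps) u@(_ ∷ u′) =
    cong₂ _∷_ (updateAt-updates p _)
              (trans (map-updateAt-∉ ps (Unique[x∷xs]⇒x∉xs u)) (map-assign xs ps u′))

  incl-branches : ∀ {Δ k} {xs : Vec Bool k} {ps : Vec (Fin n) k} .{d} →
                  Δ ⊢ incl xs ps d → Δ ⊩ λ Δ′ → ∃ λ w → Δ′ ⊢-atoms w × xs ≡ map w ps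
  incl-branches {xs = xs} {ps} {d} D =
    ⊩-map (λ (w , _ , E , total , ⊑) →
             w , ⊢⟨⟩-total⇒⊢-atoms (λ q → total (∈-allFin q)) E ,
             trans (sym (map-assign xs ps u)) (sym (map-cong-∈ ps (proj₂ ∘ ⊑ _))))
          (saturate (allFin n) (⊢⟨⟩⁺ refl u (subst-incl (sym (map-assign xs ps u)) D)))
    where
    u = recompute (unique? (toList ps)) d

  -- Teams are coded as subsets of Fin (2 ^ n), on which strict inclusion is well-founded.
  encode : Valuation n → Fin (2 ^ n)
  encode v = funToFin (Inverse.from 2↔Bool ∘ v)

  encode-injective : ∀ {v w} → encode v ≡ encode w → v ≗ w
  encode-injective {v} {w} eq p =
    trans (sym (decode-encode v)) (trans (cong decode eq) (decode-encode w))
    where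
    decode : Fin (2 ^ n) → Bool
    decode i = Inverse.to 2↔Bool (finToFun i p)
    decode-encode : ∀ u → decode (encode u) ≡ u p
    decode-encode u =
      trans (cong (Inverse.to 2↔Bool) (finToFun-funToFin _ p)) (Inverse.strictlyInverseˡ 2↔Bool (u p))

  team : Subset (2 ^ n) → Team n
  team S v = lookup S (encode v)

  ∈-team⁺ : ∀ S {v} → encode v ∈ₛ S → v ∈ᵀ team S
  ∈-team⁺ S = []=⇒lookup

  ∈-team⁻ : ∀ S {v} → v ∈ᵀ team S → encode v ∈ₛ S
  ∈-team⁻ S {v} = lookup⇒[]= (encode v) S

  team-mono : ∀ {S S′} → S ⊆ₛ S′ → team S ⊆ᵀ team S′
  team-mono {S} {S′} S⊆S′ = ∈-team⁺ S′ ∘ S⊆S′ ∘ ∈-team⁻ S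

  ⊢-team-∪ : ∀ {Δ} S {w} → Δ ⊢-team team S → Δ ⊢-atoms w → Δ ⊢-team team (S ∪ ⁅ encode w ⁆)
  ⊢-team-∪ S {w} F W v∈ with x∈p∪q⁻ S ⁅ encode w ⁆ (∈-team⁻ (S ∪ ⁅ encode w ⁆) v∈)
  ... | inj₁ v∈S = F (∈-team⁺ S v∈S)
  ... | inj₂ v∈w = ⊢-atoms-resp (encode-injective (x∈⁅y⁆⇒x≡y _ v∈w)) W

  ⊨-gain⇒⊂ : ∀ {S S′} ψ → S ⊆ₛ S′ → team S′ ⊨ ψ → ¬ team S ⊨ ψ → S ⊂ S′
  ⊨-gain⇒⊂ ψ S⊆S′ sat unsat with ⊆⇒⊂⊎⊇ S⊆S′
  ... | inj₁ S⊂S′ = S⊂S′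
  ... | inj₂ S′⊆S = contradiction (⊨-mono ψ (team-mono S′⊆S) sat) unsat

  Refinement : Subset (2 ^ n) → Formula n → Ctx n → Set₁
  Refinement S ψ Δ = ∃ λ S′ → S ⊆ₛ S′ × Δ ⊢-team team S′ × team S′ ⊨ ψ

  refine : ∀ {Δ S} ψ → Δ ⊢ ψ → Δ ⊢-team team S → Δ ⊩ Refinement S ψ
  refine ⊤ᶠ _ F = ⊩-return (_ , id , F , tt)
  refine {S = S} (incl xs ps d) D F = ⊩-bind (incl-branches D) λ s (w , W , xs≡) →
    let w∈ = ∈-team⁺ (S ∪ ⁅ encode w ⁆) (x∈p∪q⁺ (inj₂ (x∈⁅x⁆ (encode w)))) in
    ⊩-return (S ∪ ⁅ encode w ⁆ , p⊆p∪q _ , ⊢-team-∪ S (⊢-team-weaken s F) W ,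
              (w , w∈) , λ _ _ → w , w∈ , xs≡)
  refine (φ ∧ᶠ ψ) D F = ⊩-bind (refine φ (∧E₁ D) F) λ s (S₁ , S⊆S₁ , F₁ , sat₁) →
    ⊩-map (λ (S₂ , S₁⊆S₂ , F₂ , sat₂) → S₂ , S₁⊆S₂ ∘ S⊆S₁ , F₂ , ⊨-mono φ (team-mono S₁⊆S₂) sat₁ , sat₂)
          (refine ψ (∧E₂ (weaken s D)) F₁)
  refine (φ ⊔ᶠ ψ) D F = ⊩-bind (⊔-cases D) λ where
    s (inj₁ Dφ) → ⊩-map (λ (S′ , S⊆S′ , F′ , sat) → S′ , S⊆S′ , F′ , inj₁ sat)
                        (refine φ Dφ (⊢-team-weaken s F))
    s (inj₂ Dψ) → ⊩-map (λ (S′ , S⊆S′ , F′ , sat) → S′ , S⊆S′ , F′ , inj₂ sat)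
                        (refine ψ Dψ (⊢-team-weaken s F))

  module _ (em : ExcludedMiddle 0ℓ) {Γ : Ctx n} {φ : Formula n} (Γ⊨φ : Γ ⊨ˢ φ) where

    complete-from : ∀ {S} → Acc _⊃_ S → ∀ {Δ} → Γ ⊆ᶜ Δ → Δ ⊢-team team S → Δ ⊢ φ
    complete-from {S} (acc rec) Γ⊆Δ F with em {∃ λ ψ → Γ ψ × ¬ team S ⊨ ψ}
    ... | no ∄unsat = ⊢-team⇒⊢ φ F (Γ⊨φ (team S) λ ψ ψ∈Γ → em⇒dne em λ unsat → ∄unsat (ψ , ψ∈Γ , unsat))
    ... | yes (ψ , ψ∈Γ , unsat) = run (refine ψ (assm (Γ⊆Δ ψ ψ∈Γ)) F) λ Δ⊆Δ′ (S′ , S⊆S′ , F′ , sat) →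
      complete-from (rec (⊨-gain⇒⊂ ψ S⊆S′ sat unsat)) (⊆ᶜ-trans Γ⊆Δ Δ⊆Δ′) F′

mainTheorem12 : ExcludedMiddle 0ℓ →
    ∀ {n : ℕ} (Γ : Ctx n) (φ : Formula n) → Γ ⊨ˢ φ → Γ ⊢ φ
mainTheorem12 em {n} Γ φ Γ⊨φ =
  complete-from {n} em Γ⊨φ (⊃-wellFounded ∅) (λ _ → id) (λ v∈∅ → contradiction (∈-team⁻ {n} ∅ v∈∅) ∉⊥)
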